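{- Let $n,d$ be natural numbers with $n\ge 3$ and $1\le d\le\sigma^\square_V(C_n)$, where $C_n$ is the cycle on $n$ vertices. Then $\mathrm{cap}^\square_d(C_n)=\left\lfloor\frac{n}{d}\right\rfloor$ if $n\not\equiv 0\pmod d$, and $\mathrm{cap}^\square_d(C_n)=\frac{n}{d}-1$ if $n\equiv 0\pmod d$.
   Context: $d_G$ denotes shortest-path distance. For an integer $\ell\ge 0$, a weak walk of length $\ell$ on a graph $G$ is a function $f:\{0,\dots,\ell\}\to V(G)$ with $f(i)=f(i+1)$ or $f(i)f(i+1)\in E(G)$ for all $0\le i<\ell$; a weak $\ell$-track is a surjective one. For $f,g:\{0,\dots,\ell\}\to V(G)$, $m_G(f,g)=\min_i d_G(f(i),g(i))$; for a family $F=\{f_1,\dots,f_p\}$ with $p\ge2$, $m_G(F)=\min_{i\ne j}m_G(f_i,f_j)$, and $m_G(F)=\infty$ if $p=1$. A family $F=\{f_1,\dots,f_p\}$ of weak walks of length $\ell$ is patient if for each $i\in\{0,\dots,\ell-1\}$ there is $j$ with $f_j(i)f_j(i+1)\in E(G)$ and $f_{j'}(i)=f_{j'}(i+1)$ for all $j'\ne j$; a patient $\ell$-tour is a patient family all of whose members are weak $\ell$-tracks. $\sigma^\square_V(G)=\max\{m_G(f,g):\ell\ge0,\ \{f,g\}\text{ a patient }\ell\text{ -tour}\}$ (it is known that $\sigma^\square_V(C_n)=\lfloor n/2\rfloor$ for $n$ odd and $n/2-1$ for $n$ even). For natural $d\le\sigma^\square_V(G)$, $\mathrm{cap}^\square_d(G)$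 is the maximum $c$ such that there is a patient $\ell$-tour $F=\{f_1,\dots,f_c\}$ (some $\ell$) with $m_G(F)=d$. -}

module Defs where

open import Data.Nat using (ℕ; zero; suc; _≤_; _%_)
open import Data.Fin using (Fin; toℕ; inject₁)
open import Data.Product using (Σ; ∃; ∃-syntax; _×_; _,_)
open import Data.Sum using (_⊎_)
open import Relation.Nullary using (¬_)
open import Relation.Binary.PropositionalEquality using (_≡_; _≢_)

record Graph (N : ℕ) : Set₁ where
  field
    Adj : Fin N → Fin N → Set
open Graph public

CycSucc : (n : ℕ) → Fin n → Fin n → Set
CycSucc n i j = (suc (toℕ i) ≡ toℕ j) ⊎ ((suc (toℕ i) ≡ n) × (toℕ j ≡ 0))

C : (n : ℕ) → Graph n
C n = record { Adj = λ i j → CycSucc n i j ⊎ CycSucc n j i }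

module _ {N : ℕ} (G : Graph N) where

  data Walk : Fin N → Fin N → ℕ → Set where
    nil  : ∀ {u} → Walk u u 0
    cons : ∀ {u w v k} → Adj G u w → Walk w v k → Walk u v (suc k)

  Dist : Fin N → Fin N → ℕ → Set
  Dist u v k = Walk u v k × (∀ k′ → Walk u v k′ → k ≤ k′)

  Seq : ℕ → Set
  Seq ℓ = Fin (suc ℓ) → Fin N

  WeakWalk : (ℓ : ℕ) → Seq ℓ → Set
  WeakWalk ℓ f = ∀ (i : Fin ℓ) → (f (inject₁ i) ≡ f (Fin.suc i)) ⊎ Adj G (f (inject₁ i)) (f (Fin.suc i))

  WeakTrack : (ℓ : ℕ) → Seq ℓ → Set
  WeakTrack ℓ f = WeakWalk ℓ f × (∀ (v : Fin N) → ∃[ i ] f i ≡ v)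

  MinDist : ∀ {ℓ} → Seq ℓ → Seq ℓ → ℕ → Set
  MinDist f g m = (∃[ i ] Dist (f i) (g i) m)
                × (∀ i k → Dist (f i) (g i) k → m ≤ k)

  -- FamMinDist F d :  m_G(F) = d, for a family F = {f_0,…,f_{p-1}}.
  -- (For p ≤ 1 there is no pair, m_G(F) = ∞, and this is unsatisfiable.)
  FamMinDist : ∀ {p ℓ} → (Fin p → Seq ℓ) → ℕ → Set
  FamMinDist {p} F d = (∃[ i ] ∃[ j ] (i ≢ j × MinDist (F i) (F j) d))
                     × (∀ (i j : Fin p) → i ≢ j → ∀ m → MinDist (F i) (F j) m → d ≤ m)

  Patient : ∀ {p} (ℓ : ℕ) → (Fin p → Seq ℓ) → Set
  Patient {p} ℓ F =
      (∀ j → WeakWalk ℓ (F j))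
    × (∀ (i : Fin ℓ) → ∃[ j ] ( Adj G (F j (inject₁ i)) (F j (Fin.suc i))
                              × (∀ j′ → j′ ≢ j → F j′ (inject₁ i) ≡ F j′ (Fin.suc i))))

  PatientTour : ∀ {p} (ℓ : ℕ) → (Fin p → Seq ℓ) → Set
  PatientTour ℓ F = Patient ℓ F × (∀ j → WeakTrack ℓ (F j))

  IsSigma : ℕ → Set
  IsSigma s = (∃[ ℓ ] ∃[ F ] (PatientTour {2} ℓ F × MinDist (F Fin.zero) (F (Fin.suc Fin.zero)) s))
            × (∀ ℓ (F : Fin 2 → Seq ℓ) m → PatientTour ℓ F
                 → MinDist (F Fin.zero) (F (Fin.suc Fin.zero)) m → m ≤ s)

  IsCap : ℕ → ℕ → Set
  IsCap d c = (∃[ ℓ ] ∃[ F ] (PatientTour {c} ℓ F × FamMinDist F d))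
            × (∀ c′ ℓ (F : Fin c′ → Seq ℓ) → PatientTour ℓ F → FamMinDist F d → c′ ≤ c)

-- If c walkers on C_n stay pairwise at distance at least d, the arcs of d consecutive vertices starting
-- at the walkers are pairwise disjoint, so c * d ≤ n. In a step of a patient tour only one walker moves,
-- to a neighbour, and some vertex of its old arc is then covered by no arc at all; hence c * d < n.
-- Conversely, for 2 ≤ c with c * d < n, walkers starting at 0, d, …, (c - 1) * d that advance one at a
-- time, the frontmost first, form a patient tour whose pairwise distances never drop below d.
-- So cap_d(C_n) is the largest c with c * d < n; the hypothesis d ≤ σ(C_n) is used, through the upper
-- bound for two walkers, only to get 2 * d < n, which makes this c at least 2.
module Submission where

open import Defs
open import Data.Nat as ℕ
  using (ℕ; zero; suc; pred; _+_; _*_; _∸_; _/_; _%_; _⊓_; _⊔_; ∣_-_∣; _≤_; _<_; _≤?_;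
         z≤n; s≤s; z<s; s≤s⁻¹; NonZero; >-nonZero; >-nonZero⁻¹)
open import Data.Nat.Properties hiding (_≟_)
open import Data.Nat.DivMod
open import Data.Nat.Divisibility using (_∣_; divides; ∣⇒≤)
open import Data.Nat.Solver using (module +-*-Solver)
open import Data.Fin as Fin using (Fin; toℕ; fromℕ; fromℕ<; inject₁; remQuot; combine; _≟_)
open import Data.Fin.Properties
  using (toℕ-fromℕ; toℕ-fromℕ<; toℕ-injective; toℕ<n; toℕ-inject₁; combine-remQuot; injective⇒≤)
open import Data.Product using (_×_; _,_; ∃-syntax; ∃₂; uncurry)
open import Data.Sum using (_⊎_; inj₁; inj₂)
open import Data.Vec.Functional using (_∷_)
open import Function using (_∘_; Injective)
open import Relation.Binary.Definitions using (tri<; tri≈; tri>)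
open import Relation.Binary.PropositionalEquality
open import Relation.Nullary using (¬_; yes; no; contradiction)

argmin : ∀ {ℓ} (h : Fin (suc ℓ) → ℕ) → ∃[ i ] (∀ j → h i ≤ h j)
argmin {zero}  h = Fin.zero , λ { Fin.zero → ≤-refl }
argmin {suc ℓ} h with argmin (h ∘ Fin.suc)
... | i , hi≤ with h Fin.zero ≤? h (Fin.suc i)
...   | yes h0≤hi = Fin.zero , λ { Fin.zero → ≤-refl ; (Fin.suc j) → ≤-trans h0≤hi (hi≤ j) }
...   | no  h0≰hi = Fin.suc i , λ { Fin.zero → <⇒≤ (≰⇒> h0≰hi) ; (Fin.suc j) → hi≤ j }

injective-missing⇒< : ∀ {a b} {f : Fin a → Fin b} (z : Fin b) →
                      Injective _≡_ _≡_ f → (∀ x → f x ≢ z) → a < b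
injective-missing⇒< {f = f} z f-inj missing = injective⇒≤ {f = z ∷ f} ∷-injective
  where
  ∷-injective : Injective _≡_ _≡_ (z ∷ f)
  ∷-injective {Fin.zero}  {Fin.zero}  _  = refl
  ∷-injective {Fin.zero}  {Fin.suc y} eq = contradiction (sym eq) (missing y)
  ∷-injective {Fin.suc x} {Fin.zero}  eq = contradiction eq (missing x)
  ∷-injective {Fin.suc x} {Fin.suc y} eq = cong Fin.suc (f-inj eq)

remQuot-injective : ∀ {c} d → Injective _≡_ _≡_ (remQuot {c} d)
remQuot-injective {c} d {x} {y} eq =
  trans (sym (combine-remQuot {c} d x)) (trans (cong (uncurry combine) eq) (combine-remQuot {c} d y))

weakTrack₀-trivial : ∀ {N} {G : Graph N} {f : Seq G 0} → WeakTrack G 0 f → ∀ u v → u ≡ v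
weakTrack₀-trivial (_ , onto) u v with onto u | onto v
... | Fin.zero , fu≡u | Fin.zero , fv≡v = trans (sym fu≡u) fv≡v

[m/n]*n<m : ∀ {m n} .{{_ : NonZero n}} → ¬ n ∣ m → m / n * n < m
[m/n]*n<m {m} {n} n∤m = ≤∧≢⇒< (m/n*n≤m m n) (λ eq → n∤m (divides (m / n) (sym eq)))

m<[1+m/n]*n : ∀ m n .{{_ : NonZero n}} → m < suc (m / n) * n
m<[1+m/n]*n m n = begin-strict
  m                   ≡⟨ m≡m%n+[m/n]*n m n ⟩
  m % n + m / n * n   <⟨ +-monoˡ-< (m / n * n) (m%n<n m n) ⟩
  n + m / n * n       ≡⟨⟩
  suc (m / n) * n     ∎
  where open ≤-Reasoning

[m/n∸1]*n<m : ∀ {m n} .{{_ : NonZero m}} .{{_ : NonZero n}} → n ∣ m → (m / n ∸ 1) * n < m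
[m/n∸1]*n<m {m} {n} n∣m = begin-strict
  (m / n ∸ 1) * n   ≡⟨ *-distribʳ-∸ n (m / n) 1 ⟩
  m / n * n ∸ 1 * n ≡⟨ cong₂ _∸_ (m/n*n≡m n∣m) (*-identityˡ n) ⟩
  m ∸ n             <⟨ ∸-monoʳ-< (>-nonZero⁻¹ n) (∣⇒≤ n∣m) ⟩
  m                 ∎
  where open ≤-Reasoning

m≡[1+[m/n∸1]]*n : ∀ {m n} .{{_ : NonZero m}} .{{_ : NonZero n}} → n ∣ m → m ≡ suc (m / n ∸ 1) * n
m≡[1+[m/n∸1]]*n {m} {n} n∣m = begin
  m                   ≡⟨ m/n*n≡m n∣m ⟨
  m / n * n           ≡⟨ cong (_* n) (m+[n∸m]≡n (m≥n⇒m/n>0 (∣⇒≤ n∣m))) ⟨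
  suc (m / n ∸ 1) * n ∎
  where open ≡-Reasoning

module Modular (m : ℕ) .{{_ : NonZero m}} where

  mod-+ʳ : ∀ {x y} z → x % m ≡ y % m → (x + z) % m ≡ (y + z) % m
  mod-+ʳ {x} {y} z eq = begin
    (x + z) % m               ≡⟨ %-distribˡ-+ x z m ⟩
    (x % m + z % m) % m       ≡⟨ cong (λ w → (w + z % m) % m) eq ⟩
    (y % m + z % m) % m       ≡⟨ %-distribˡ-+ y z m ⟨
    (y + z) % m               ∎
    where open ≡-Reasoning

  mod-+ˡ : ∀ {x y} z → x % m ≡ y % m → (z + x) % m ≡ (z + y) % m
  mod-+ˡ {x} {y} z eq = begin
    (z + x) % m ≡⟨ cong (_% m) (+-comm z x) ⟩
    (x + z) % m ≡⟨ mod-+ʳ z eq ⟩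
    (y + z) % m ≡⟨ cong (_% m) (+-comm y z) ⟩
    (z + y) % m ∎
    where open ≡-Reasoning

  [x%m+y]%m≡[x+y]%m : ∀ x y → (x % m + y) % m ≡ (x + y) % m
  [x%m+y]%m≡[x+y]%m x y = mod-+ʳ y (m%n%n≡m%n x m)

  [x+y%m]%m≡[x+y]%m : ∀ x y → (x + y % m) % m ≡ (x + y) % m
  [x+y%m]%m≡[x+y]%m x y = mod-+ˡ x (m%n%n≡m%n y m)

  -- Adding z * (m ∸ 1) undoes the shift by z, since z + z * (m ∸ 1) = z * m.
  mod-cancelʳ-+ : ∀ {x y} z → (x + z) % m ≡ (y + z) % m → x % m ≡ y % m
  mod-cancelʳ-+ {x} {y} z eq = begin
    x % m                         ≡⟨ [m+kn]%n≡m%n x z m ⟨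
    (x + z * m) % m               ≡⟨ cong (λ w → (x + w) % m) z*m≡z+z*[m∸1] ⟩
    (x + (z + z * pred m)) % m    ≡⟨ cong (_% m) (+-assoc x z _) ⟨
    (x + z + z * pred m) % m      ≡⟨ mod-+ʳ (z * pred m) eq ⟩
    (y + z + z * pred m) % m      ≡⟨ cong (_% m) (+-assoc y z _) ⟩
    (y + (z + z * pred m)) % m    ≡⟨ cong (λ w → (y + w) % m) z*m≡z+z*[m∸1] ⟨
    (y + z * m) % m               ≡⟨ [m+kn]%n≡m%n y z m ⟩
    y % m                         ∎
    where
    open ≡-Reasoning
    z*m≡z+z*[m∸1] : z * m ≡ z + z * pred m
    z*m≡z+z*[m∸1] = trans (cong (z *_) (sym (suc-pred m))) (*-suc z (pred m))

  mod-cancelˡ-+ : ∀ {x y} z → (z + x) % m ≡ (z + y) % m → x % m ≡ y % m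
  mod-cancelˡ-+ {x} {y} z eq =
    mod-cancelʳ-+ z (trans (cong (_% m) (+-comm x z)) (trans eq (cong (_% m) (+-comm z y))))

  -- The least k with u + k ≡ v (mod m), when u ≤ m and v < m.
  forward : ℕ → ℕ → ℕ
  forward u v = (m ∸ u + v) % m

  forward-< : ∀ u v → forward u v < m
  forward-< u v = m%n<n (m ∸ u + v) m

  +-forward : ∀ {u v} → u ≤ m → v < m → (u + forward u v) % m ≡ v
  +-forward {u} {v} u≤m v<m = begin
    (u + (m ∸ u + v) % m) % m ≡⟨ [x+y%m]%m≡[x+y]%m u (m ∸ u + v) ⟩
    (u + (m ∸ u + v)) % m     ≡⟨ cong (_% m) (+-assoc u (m ∸ u) v) ⟨
    (u + (m ∸ u) + v) % m     ≡⟨ cong (λ w → (w + v) % m) (m+[n∸m]≡n u≤m) ⟩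
    (m + v) % m               ≡⟨ cong (_% m) (+-comm m v) ⟩
    (v + m) % m               ≡⟨ [m+n]%n≡m%n v m ⟩
    v % m                     ≡⟨ m<n⇒m%n≡m v<m ⟩
    v                         ∎
    where open ≡-Reasoning

  forward-+ : ∀ {u} k → u ≤ m → forward u ((u + k) % m) ≡ k % m
  forward-+ {u} k u≤m = begin
    (m ∸ u + (u + k) % m) % m ≡⟨ [x+y%m]%m≡[x+y]%m (m ∸ u) (u + k) ⟩
    (m ∸ u + (u + k)) % m     ≡⟨ cong (_% m) (+-assoc (m ∸ u) u k) ⟨
    (m ∸ u + u + k) % m       ≡⟨ cong (λ w → (w + k) % m) (m∸n+n≡m u≤m) ⟩
    (m + k) % m               ≡⟨ cong (_% m) (+-comm m k) ⟩
    (k + m) % m               ≡⟨ [m+n]%n≡m%n k m ⟩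
    k % m                     ∎
    where open ≡-Reasoning

  forward-≤ : ∀ {u v} k → u ≤ m → (u + k) % m ≡ v → forward u v ≤ k
  forward-≤ k u≤m refl = ≤-trans (≤-reflexive (forward-+ k u≤m)) (m%n≤m k m)

  forward-≡ : ∀ {u v k} → u ≤ m → k < m → (u + k) % m ≡ v → forward u v ≡ k
  forward-≡ {k = k} u≤m k<m refl = trans (forward-+ k u≤m) (m<n⇒m%n≡m k<m)

  forward-≤-∸ : ∀ {u v a b} → u ≤ m → v < m → b ≤ a → (u + a) % m ≡ (v + b) % m →
                forward u v ≤ a ∸ b
  forward-≤-∸ {u} {v} {a} {b} u≤m v<m b≤a eq = forward-≤ (a ∸ b) u≤m (begin
    (u + (a ∸ b)) % m ≡⟨ mod-cancelʳ-+ b shifted ⟩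
    v % m             ≡⟨ m<n⇒m%n≡m v<m ⟩
    v                 ∎)
    where
    open ≡-Reasoning
    shifted : (u + (a ∸ b) + b) % m ≡ (v + b) % m
    shifted = trans (cong (_% m) (trans (+-assoc u (a ∸ b) b) (cong (u +_) (m∸n+n≡m b≤a)))) eq

  offset-injective : ∀ {u a b} → a < m → b < m → (u + a) % m ≡ (u + b) % m → a ≡ b
  offset-injective {u} {a} {b} a<m b<m eq = begin
    a     ≡⟨ m<n⇒m%n≡m a<m ⟨
    a % m ≡⟨ mod-cancelˡ-+ u eq ⟩
    b % m ≡⟨ m<n⇒m%n≡m b<m ⟩
    b     ∎
    where open ≡-Reasoning

  [r+q*m]/m≡q : ∀ {r} q → r < m → (r + q * m) / m ≡ q
  [r+q*m]/m≡q {r} q r<m = begin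
    (r + q * m) / m   ≡⟨ +-distrib-/-∣ʳ r (divides q refl) ⟩
    r / m + q * m / m ≡⟨ cong₂ _+_ (m<n⇒m/n≡0 r<m) (m*n/n≡m q m) ⟩
    q                 ∎
    where open ≡-Reasoning

  [1+x]/m≡x/m : ∀ x → suc (x % m) < m → suc x / m ≡ x / m
  [1+x]/m≡x/m x x%m+1<m = begin
    suc x / m                     ≡⟨ cong (λ y → suc y / m) (m≡m%n+[m/n]*n x m) ⟩
    (suc (x % m) + x / m * m) / m ≡⟨ [r+q*m]/m≡q (x / m) x%m+1<m ⟩
    x / m                         ∎
    where open ≡-Reasoning

  [1+x]/m≡1+x/m : ∀ x → suc (x % m) ≡ m → suc x / m ≡ suc (x / m)
  [1+x]/m≡1+x/m x x%m+1≡m = begin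
    suc x / m                     ≡⟨ cong (λ y → suc y / m) (m≡m%n+[m/n]*n x m) ⟩
    (suc (x % m) + x / m * m) / m ≡⟨ cong (λ y → (y + x / m * m) / m) x%m+1≡m ⟩
    suc (x / m) * m / m           ≡⟨ m*n/n≡m (suc (x / m)) m ⟩
    suc (x / m)                   ∎
    where open ≡-Reasoning

  [x+k]/m≤1+x/m : ∀ x {k} → k < m → (x + k) / m ≤ suc (x / m)
  [x+k]/m≤1+x/m x {k} k<m = begin
    (x + k) / m     ≤⟨ /-monoˡ-≤ m (+-monoʳ-≤ x (<⇒≤ k<m)) ⟩
    (x + m) / m     ≡⟨ +-distrib-/-∣ʳ x (divides 1 (sym (*-identityˡ m))) ⟩
    x / m + m / m   ≡⟨ cong (x / m +_) (n/n≡1 m) ⟩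
    x / m + 1       ≡⟨ +-comm (x / m) 1 ⟩
    suc (x / m)     ∎
    where open ≤-Reasoning

module Cycle (n : ℕ) .{{_ : NonZero n}} where
  open Modular n

  toℕ-mod : ∀ x → toℕ (x mod n) ≡ x % n
  toℕ-mod x = toℕ-fromℕ< (m%n<n x n)

  %≡toℕ⇒mod≡ : ∀ {x v} → x % n ≡ toℕ v → x mod n ≡ v
  %≡toℕ⇒mod≡ {x} eq = toℕ-injective (trans (toℕ-mod x) eq)

  %≡%⇒mod≡mod : ∀ {x y} → x % n ≡ y % n → x mod n ≡ y mod n
  %≡%⇒mod≡mod {x} {y} eq = %≡toℕ⇒mod≡ (trans eq (sym (toℕ-mod y)))

  mod≡mod⇒%≡% : ∀ {x y} → x mod n ≡ y mod n → x % n ≡ y % n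
  mod≡mod⇒%≡% {x} {y} eq = trans (sym (toℕ-mod x)) (trans (cong toℕ eq) (toℕ-mod y))

  mod-toℕ : (u : Fin n) → toℕ u mod n ≡ u
  mod-toℕ u = %≡toℕ⇒mod≡ (m<n⇒m%n≡m (toℕ<n u))

  toℕ≤n : (u : Fin n) → toℕ u ≤ n
  toℕ≤n u = <⇒≤ (toℕ<n u)

  CycSucc⇒≡suc% : ∀ {u w} → CycSucc n u w → toℕ w ≡ suc (toℕ u) % n
  CycSucc⇒≡suc% {w = w} (inj₁ eq) =
    trans (sym eq) (sym (m<n⇒m%n≡m (subst (_< n) (sym eq) (toℕ<n w))))
  CycSucc⇒≡suc% (inj₂ (eq , w≡0)) = trans w≡0 (sym (trans (cong (_% n) eq) (n%n≡0 n)))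

  suc%≡suc[%]% : ∀ x → suc x % n ≡ suc (x % n) % n
  suc%≡suc[%]% x = mod-+ˡ 1 (sym (m%n%n≡m%n x n))

  mod-CycSucc : ∀ x → CycSucc n (x mod n) (suc x mod n)
  mod-CycSucc x with m≤n⇒m<n∨m≡n (m%n<n x n)
  ... | inj₁ x%n+1<n = inj₁ (begin
    suc (toℕ (x mod n)) ≡⟨ cong suc (toℕ-mod x) ⟩
    suc (x % n)         ≡⟨ m<n⇒m%n≡m x%n+1<n ⟨
    suc (x % n) % n     ≡⟨ suc%≡suc[%]% x ⟨
    suc x % n           ≡⟨ toℕ-mod (suc x) ⟨
    toℕ (suc x mod n)   ∎)
    where open ≡-Reasoning
  ... | inj₂ x%n+1≡n = inj₂ (trans (cong suc (toℕ-mod x)) x%n+1≡n , (begin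
    toℕ (suc x mod n) ≡⟨ toℕ-mod (suc x) ⟩
    suc x % n         ≡⟨ suc%≡suc[%]% x ⟩
    suc (x % n) % n   ≡⟨ cong (_% n) x%n+1≡n ⟩
    n % n             ≡⟨ n%n≡0 n ⟩
    0                 ∎))
    where open ≡-Reasoning

  adj⇒ : ∀ {u w} → Adj (C n) u w → (toℕ w ≡ suc (toℕ u) % n) ⊎ (toℕ u ≡ suc (toℕ w) % n)
  adj⇒ (inj₁ u→w) = inj₁ (CycSucc⇒≡suc% u→w)
  adj⇒ (inj₂ w→u) = inj₂ (CycSucc⇒≡suc% w→u)

  mod-adj : ∀ x → Adj (C n) (x mod n) (suc x mod n)
  mod-adj x = inj₁ (mod-CycSucc x)

  adj-sym : ∀ {u w} → Adj (C n) u w → Adj (C n) w u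
  adj-sym (inj₁ u→w) = inj₂ u→w
  adj-sym (inj₂ w→u) = inj₁ w→u

  dist : Fin n → Fin n → ℕ
  dist u v = forward (toℕ u) (toℕ v) ⊓ forward (toℕ v) (toℕ u)

  dist-comm : ∀ u v → dist u v ≡ dist v u
  dist-comm u v = ⊓-comm (forward (toℕ u) (toℕ v)) (forward (toℕ v) (toℕ u))

  dist<n : ∀ u v → dist u v < n
  dist<n u v = ≤-<-trans (m⊓n≤m _ _) (forward-< (toℕ u) (toℕ v))

  dist≤∣a-b∣ : ∀ {u v a b} → (toℕ u + a) % n ≡ (toℕ v + b) % n → dist u v ≤ ∣ a - b ∣
  dist≤∣a-b∣ {u} {v} {a} {b} eq with ≤-total b a
  ... | inj₁ b≤a = begin
    dist u v                  ≤⟨ m⊓n≤m _ _ ⟩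
    forward (toℕ u) (toℕ v)   ≤⟨ forward-≤-∸ (toℕ≤n u) (toℕ<n v) b≤a eq ⟩
    a ∸ b                     ≤⟨ m∸n≤∣m-n∣ a b ⟩
    ∣ a - b ∣                 ∎
    where open ≤-Reasoning
  ... | inj₂ a≤b = begin
    dist u v                  ≤⟨ m⊓n≤n _ _ ⟩
    forward (toℕ v) (toℕ u)   ≤⟨ forward-≤-∸ (toℕ≤n v) (toℕ<n u) a≤b (sym eq) ⟩
    b ∸ a                     ≡⟨ m≤n⇒∣m-n∣≡n∸m a≤b ⟨
    ∣ a - b ∣                 ∎
    where open ≤-Reasoning

  -- A walk makes a forward and b backward steps, so it ends at u + a - b.
  walk-offsets : ∀ {u v k} → Walk (C n) u v k →
                 ∃₂ λ a b → a + b ≡ k × (toℕ u + a) % n ≡ (toℕ v + b) % n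
  walk-offsets nil = 0 , 0 , refl , refl
  walk-offsets {u} {v} (cons {w = w} u~w p) with walk-offsets p | adj⇒ u~w
  ... | a , b , refl , eq | inj₁ w≡u+1 = suc a , b , refl , (begin
    (toℕ u + suc a) % n       ≡⟨ cong (_% n) (+-suc (toℕ u) a) ⟩
    (suc (toℕ u) + a) % n     ≡⟨ [x%m+y]%m≡[x+y]%m (suc (toℕ u)) a ⟨
    (suc (toℕ u) % n + a) % n ≡⟨ cong (λ x → (x + a) % n) w≡u+1 ⟨
    (toℕ w + a) % n           ≡⟨ eq ⟩
    (toℕ v + b) % n           ∎)
    where open ≡-Reasoning
  ... | a , b , refl , eq | inj₂ u≡w+1 = a , suc b , +-suc a b , (begin
    (toℕ u + a) % n           ≡⟨ cong (λ x → (x + a) % n) u≡w+1 ⟩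
    (suc (toℕ w) % n + a) % n ≡⟨ [x%m+y]%m≡[x+y]%m (suc (toℕ w)) a ⟩
    suc (toℕ w + a) % n       ≡⟨ mod-+ˡ 1 eq ⟩
    suc (toℕ v + b) % n       ≡⟨ cong (_% n) (+-suc (toℕ v) b) ⟨
    (toℕ v + suc b) % n       ∎)
    where open ≡-Reasoning

  walk⇒dist≤ : ∀ {u v k} → Walk (C n) u v k → dist u v ≤ k
  walk⇒dist≤ {u} {v} p with walk-offsets p
  ... | a , b , refl , eq = ≤-trans (dist≤∣a-b∣ {u} {v} eq) (≤-trans (∣m-n∣≤m⊔n a b) (m⊔n≤m+n a b))

  ascending-walk : ∀ k x → Walk (C n) (x mod n) ((k + x) mod n) k
  ascending-walk zero    x = nil
  ascending-walk (suc k) x = cons (mod-adj x)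
    (subst (λ y → Walk (C n) (suc x mod n) (y mod n) k) (+-suc k x) (ascending-walk k (suc x)))

  descending-walk : ∀ k x → Walk (C n) ((k + x) mod n) (x mod n) k
  descending-walk zero    x = nil
  descending-walk (suc k) x = cons (adj-sym (mod-adj (k + x))) (descending-walk k x)

  forward-mod : ∀ u v → (forward (toℕ u) (toℕ v) + toℕ u) mod n ≡ v
  forward-mod u v = %≡toℕ⇒mod≡
    (trans (cong (_% n) (+-comm _ (toℕ u))) (+-forward (toℕ≤n u) (toℕ<n v)))

  walk-dist : ∀ u v → Walk (C n) u v (dist u v)
  walk-dist u v with ≤-total (forward (toℕ u) (toℕ v)) (forward (toℕ v) (toℕ u))
  ... | inj₁ u→v-shorter = subst₂ (λ x y → Walk (C n) x y (dist u v)) (mod-toℕ u) (forward-mod u v)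
    (subst (Walk (C n) _ _) (sym (m≤n⇒m⊓n≡m u→v-shorter)) (ascending-walk _ (toℕ u)))
  ... | inj₂ v→u-shorter = subst₂ (λ x y → Walk (C n) x y (dist u v)) (forward-mod v u) (mod-toℕ v)
    (subst (Walk (C n) _ _) (sym (m≥n⇒m⊓n≡n v→u-shorter)) (descending-walk _ (toℕ v)))

  dist-Dist : ∀ u v → Dist (C n) u v (dist u v)
  dist-Dist u v = walk-dist u v , λ _ → walk⇒dist≤

  Dist⇒≡dist : ∀ {u v k} → Dist (C n) u v k → k ≡ dist u v
  Dist⇒≡dist {u} {v} (p , shortest) = ≤-antisym (shortest _ (walk-dist u v)) (walk⇒dist≤ p)

  dist-offset : ∀ x {δ} → 0 < δ → δ < n → dist (x mod n) ((x + δ) mod n) ≡ δ ⊓ (n ∸ δ)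
  dist-offset x {δ} 0<δ δ<n = begin
    dist (x mod n) ((x + δ) mod n)
      ≡⟨ cong₂ (λ a b → forward a b ⊓ forward b a) (toℕ-mod x) (toℕ-mod (x + δ)) ⟩
    forward (x % n) ((x + δ) % n) ⊓ forward ((x + δ) % n) (x % n)
      ≡⟨ cong₂ _⊓_ ascent descent ⟩
    δ ⊓ (n ∸ δ)
      ∎
    where
    open ≡-Reasoning
    ascent : forward (x % n) ((x + δ) % n) ≡ δ
    ascent = forward-≡ (m%n≤n x n) δ<n ([x%m+y]%m≡[x+y]%m x δ)
    return : ((x + δ) % n + (n ∸ δ)) % n ≡ x % n
    return = begin
      ((x + δ) % n + (n ∸ δ)) % n ≡⟨ [x%m+y]%m≡[x+y]%m (x + δ) (n ∸ δ) ⟩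
      (x + δ + (n ∸ δ)) % n       ≡⟨ cong (_% n) (+-assoc x δ (n ∸ δ)) ⟩
      (x + (δ + (n ∸ δ))) % n     ≡⟨ cong (λ y → (x + y) % n) (m+[n∸m]≡n (<⇒≤ δ<n)) ⟩
      (x + n) % n                 ≡⟨ [m+n]%n≡m%n x n ⟩
      x % n                       ∎
    descent : forward ((x + δ) % n) (x % n) ≡ n ∸ δ
    descent = forward-≡ (m%n≤n (x + δ) n) (∸-monoʳ-< 0<δ (<⇒≤ δ<n)) return

  minDist : ∀ {ℓ} (f g : Seq (C n) ℓ) → ∃[ m ] MinDist (C n) f g m
  minDist f g with argmin (λ t → dist (f t) (g t))
  ... | t , minimal = dist (f t) (g t) , (t , dist-Dist (f t) (g t)) ,
                      λ t′ k d≡k → ≤-trans (minimal t′) (≤-reflexive (sym (Dist⇒≡dist d≡k)))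

  MinDist⇒≤dist : ∀ {ℓ m} {f g : Seq (C n) ℓ} → MinDist (C n) f g m → ∀ t → m ≤ dist (f t) (g t)
  MinDist⇒≤dist {f = f} {g} (_ , minimal) t = minimal t _ (dist-Dist (f t) (g t))

  Separated : ∀ {c} → ℕ → (Fin c → Fin n) → Set
  Separated d pos = ∀ i j → i ≢ j → d ≤ dist (pos i) (pos j)

  MinDist⇒separated₂ : ∀ {ℓ m d} {F : Fin 2 → Seq (C n) ℓ} →
                       MinDist (C n) (F Fin.zero) (F (Fin.suc Fin.zero)) m →
                       d ≤ m → ∀ t → Separated d (λ i → F i t)
  MinDist⇒separated₂ m-min d≤m t Fin.zero          Fin.zero          0≢0 = contradiction refl 0≢0
  MinDist⇒separated₂ m-min d≤m t Fin.zero          (Fin.suc Fin.zero) _  = ≤-trans d≤m (MinDist⇒≤dist m-min t)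
  MinDist⇒separated₂ {F = F} m-min d≤m t (Fin.suc Fin.zero) Fin.zero _ =
    subst (_ ≤_) (dist-comm (F Fin.zero t) (F (Fin.suc Fin.zero) t)) (≤-trans d≤m (MinDist⇒≤dist m-min t))
  MinDist⇒separated₂ m-min d≤m t (Fin.suc Fin.zero) (Fin.suc Fin.zero) 1≢1 = contradiction refl 1≢1

  FamMinDist⇒separated : ∀ {c ℓ d} {F : Fin c → Seq (C n) ℓ} → FamMinDist (C n) F d →
                         ∀ t → Separated d (λ i → F i t)
  FamMinDist⇒separated {F = F} (_ , minimal) t i j i≢j with minDist (F i) (F j)
  ... | m , m-min = ≤-trans (minimal i j i≢j m m-min) (MinDist⇒≤dist m-min t)

  separated⇒FamMinDist : ∀ {c ℓ d} {F : Fin c → Seq (C n) ℓ} → (∀ t → Separated d (λ i → F i t)) →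
                         ∀ {i j t} → i ≢ j → dist (F i t) (F j t) ≡ d → FamMinDist (C n) F d
  separated⇒FamMinDist {F = F} sep {i} {j} {t} i≢j attained =
      (i , j , i≢j , (t , subst (Dist (C n) _ _) attained (dist-Dist (F i t) (F j t))) ,
                     λ t′ k d≡k → subst (_ ≤_) (sym (Dist⇒≡dist d≡k)) (sep t′ i j i≢j))
    , λ i′ j′ i′≢j′ m ((t′ , d≡m) , _) → subst (_ ≤_) (sym (Dist⇒≡dist d≡m)) (sep t′ i′ j′ i′≢j′)

  arc : ∀ {d} → Fin n → Fin d → Fin n
  arc p r = (toℕ p + toℕ r) mod n

  arc-injective : ∀ {d} p (r r′ : Fin d) → d ≤ n → arc p r ≡ arc p r′ → r ≡ r′
  arc-injective p r r′ d≤n eq = toℕ-injective (offset-injective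
    (<-≤-trans (toℕ<n r) d≤n) (<-≤-trans (toℕ<n r′) d≤n)
    (mod≡mod⇒%≡% eq))

  arcs-meet⇒dist< : ∀ {d} p q (r r′ : Fin d) → arc p r ≡ arc q r′ → dist p q < d
  arcs-meet⇒dist< p q r r′ eq = begin-strict
    dist p q                 ≤⟨ dist≤∣a-b∣ {p} {q} (mod≡mod⇒%≡% eq) ⟩
    ∣ toℕ r - toℕ r′ ∣       ≤⟨ ∣m-n∣≤m⊔n (toℕ r) (toℕ r′) ⟩
    toℕ r ⊔ toℕ r′           <⟨ ⊔-lub (toℕ<n r) (toℕ<n r′) ⟩
    _                        ∎
    where open ≤-Reasoning

  arc-step-uncovers : ∀ {d x y} → 0 < d → d < n → Adj (C n) x y →
                      ∃[ z ] (∃[ r ] arc {d} x r ≡ z) × (∀ r → arc {d} y r ≢ z)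
  arc-step-uncovers {suc e} {x} {y} _ d<n x~y with adj⇒ x~y
  ... | inj₁ y≡x+1 = x , (Fin.zero , x∈arc) , x∉arc′
    where
    x∈arc : arc {suc e} x Fin.zero ≡ x
    x∈arc = trans (cong (_mod n) (+-identityʳ (toℕ x))) (mod-toℕ x)
    x∉arc′ : ∀ r → arc y r ≢ x
    x∉arc′ r eq = 0≢1+n (sym (offset-injective (≤-<-trans (toℕ<n r) d<n) (≤-<-trans z≤n d<n) (begin
      (toℕ x + suc (toℕ r)) % n     ≡⟨ cong (_% n) (+-suc (toℕ x) (toℕ r)) ⟩
      (suc (toℕ x) + toℕ r) % n     ≡⟨ [x%m+y]%m≡[x+y]%m (suc (toℕ x)) (toℕ r) ⟨
      (suc (toℕ x) % n + toℕ r) % n ≡⟨ cong (λ w → (w + toℕ r) % n) y≡x+1 ⟨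
      (toℕ y + toℕ r) % n           ≡⟨ toℕ-mod _ ⟨
      toℕ (arc y r)                 ≡⟨ cong toℕ eq ⟩
      toℕ x                         ≡⟨ m<n⇒m%n≡m (toℕ<n x) ⟨
      toℕ x % n                     ≡⟨ cong (_% n) (+-identityʳ (toℕ x)) ⟨
      (toℕ x + 0) % n               ∎)))
      where open ≡-Reasoning
  ... | inj₂ x≡y+1 = (toℕ y + suc e) mod n , (fromℕ e , z∈arc) , z∉arc′
    where
    z∈arc : arc x (fromℕ e) ≡ (toℕ y + suc e) mod n
    z∈arc = %≡%⇒mod≡mod (begin
      (toℕ x + toℕ (fromℕ e)) % n ≡⟨ cong (λ w → (toℕ x + w) % n) (toℕ-fromℕ e) ⟩
      (toℕ x + e) % n             ≡⟨ cong (λ w → (w + e) % n) x≡y+1 ⟩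
      (suc (toℕ y) % n + e) % n   ≡⟨ [x%m+y]%m≡[x+y]%m (suc (toℕ y)) e ⟩
      (suc (toℕ y) + e) % n       ≡⟨ cong (_% n) (+-suc (toℕ y) e) ⟨
      (toℕ y + suc e) % n         ∎)
      where open ≡-Reasoning
    z∉arc′ : ∀ r → arc y r ≢ (toℕ y + suc e) mod n
    z∉arc′ r eq = <-irrefl (offset-injective (<-trans (toℕ<n r) d<n) d<n (mod≡mod⇒%≡% eq)) (toℕ<n r)

  arcs : ∀ {c d} → (Fin c → Fin n) → Fin c × Fin d → Fin n
  arcs pos (i , r) = arc (pos i) r

  arcs-injective : ∀ {c d} {pos : Fin c → Fin n} → d ≤ n → Separated d pos →
                   Injective _≡_ _≡_ (arcs {d = d} pos)
  arcs-injective {pos = pos} d≤n sep {i , r} {j , r′} eq with i ≟ j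
  ... | yes refl = cong (i ,_) (arc-injective (pos i) r r′ d≤n eq)
  ... | no  i≢j  = contradiction (arcs-meet⇒dist< (pos i) (pos j) r r′ eq) (≤⇒≯ (sep i j i≢j))

  -- The arcs at pos′ are disjoint and miss the vertex z of the mover's old arc, as the other walkers did not move.
  step-packing : ∀ {c d} {pos pos′ : Fin c → Fin n} {j} → 0 < d → d < n →
                 Separated d pos → Separated d pos′ → Adj (C n) (pos j) (pos′ j) →
                 (∀ q → q ≢ j → pos q ≡ pos′ q) → c * d < n
  step-packing {c} {d} {pos} {pos′} {j} 0<d d<n sep sep′ moved others
    with arc-step-uncovers 0<d d<n moved
  ... | z , (r₀ , z∈arc) , z∉arc′ = injective-missing⇒< z
          (λ eq → remQuot-injective d (arcs-injective {pos = pos′} (<⇒≤ d<n) sep′ eq))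
          (uncovered ∘ remQuot d)
    where
    uncovered : ∀ qr → arcs pos′ qr ≢ z
    uncovered (q , r) with q ≟ j
    ... | yes refl = z∉arc′ r
    ... | no  q≢j  = λ eq → <⇒≱ (arcs-meet⇒dist< (pos q) (pos j) r r₀
                                   (trans (cong (λ p → arc p r) (others q q≢j)) (trans eq (sym z∈arc))))
                               (sep q j q≢j)

  tour-packing : ∀ {c ℓ d} {F : Fin c → Seq (C n) ℓ} {i j : Fin c} → PatientTour (C n) ℓ F →
                 (∀ t → Separated d (λ k → F k t)) → i ≢ j → c * d < n
  tour-packing {c} {d = zero} _ _ _ = subst (_< n) (sym (*-zeroʳ c)) (>-nonZero⁻¹ n)
  tour-packing {ℓ = zero} {suc e} {F} {i} {j} (_ , tracks) sep i≢j =
    contradiction (trans (sym (m<n⇒m%n≡m 0<n)) (trans (mod≡mod⇒%≡% 0≡1) (m<n⇒m%n≡m 1<n))) 0≢1+n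
    where
    1<n : 1 < n
    1<n = ≤-<-trans (s≤s z≤n) (≤-<-trans (sep Fin.zero i j i≢j) (dist<n (F i Fin.zero) (F j Fin.zero)))
    0<n : 0 < n
    0<n = <-trans z<s 1<n
    0≡1 : 0 mod n ≡ 1 mod n
    0≡1 = weakTrack₀-trivial {G = C n} (tracks i) (0 mod n) (1 mod n)
  tour-packing {ℓ = suc ℓ} {suc e} {F} {i} {j} ((_ , steps) , _) sep i≢j with steps Fin.zero
  ... | k , moved , others = step-packing z<s d<n (sep Fin.zero) (sep (Fin.suc Fin.zero)) moved others
    where
    d<n : suc e < n
    d<n = ≤-<-trans (sep Fin.zero i j i≢j) (dist<n (F i Fin.zero) (F j Fin.zero))

  offset-separated : ∀ x {d δ} → 0 < d → d ≤ δ → δ + d ≤ n → d ≤ dist (x mod n) ((x + δ) mod n)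
  offset-separated x {d} {δ} 0<d d≤δ δ+d≤n = begin
    d                               ≤⟨ ⊓-glb d≤δ (m+n≤o⇒m≤o∸n d (subst (_≤ n) (+-comm δ d) δ+d≤n)) ⟩
    δ ⊓ (n ∸ δ)                     ≡⟨ dist-offset x (<-≤-trans 0<d d≤δ) δ<n ⟨
    dist (x mod n) ((x + δ) mod n)  ∎
    where
    open ≤-Reasoning
    δ<n : δ < n
    δ<n = <-≤-trans (m<m+n δ 0<d) δ+d≤n

  -- Walker j starts at j * d; in every round of c steps the walkers c - 1, …, 0 advance by one, in this order.
  module RoundRobin {c d : ℕ} (2≤c : 2 ≤ c) (0<d : 0 < d) (cd<n : c * d < n) where
    instance
      c≢0 : NonZero c
      c≢0 = >-nonZero (<-trans z<s 2≤c)

    module ℤ/c = Modular c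

    position : ℕ → ℕ → ℕ
    position j t = j * d + (t + j) / c

    Moves : ℕ → ℕ → Set
    Moves j t = suc ((t + j) % c) ≡ c

    position-moves : ∀ j t → Moves j t → position j (suc t) ≡ suc (position j t)
    position-moves j t moves = begin
      j * d + suc (t + j) / c     ≡⟨ cong (j * d +_) (ℤ/c.[1+x]/m≡1+x/m (t + j) moves) ⟩
      j * d + suc ((t + j) / c)   ≡⟨ +-suc (j * d) _ ⟩
      suc (position j t)          ∎
      where open ≡-Reasoning

    position-stays : ∀ j t → ¬ Moves j t → position j (suc t) ≡ position j t
    position-stays j t ¬moves =
      cong (j * d +_) (ℤ/c.[1+x]/m≡x/m (t + j) (≤∧≢⇒< (m%n<n (t + j) c) ¬moves))

    mover : ℕ → ℕ
    mover t = ℤ/c.forward (t % c) (pred c)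

    mover-moves : ∀ t → Moves (mover t) t
    mover-moves t = begin
      suc ((t + mover t) % c)       ≡⟨ cong suc (ℤ/c.[x%m+y]%m≡[x+y]%m t (mover t)) ⟨
      suc ((t % c + mover t) % c)   ≡⟨ cong suc (ℤ/c.+-forward (m%n≤n t c) (pred<c)) ⟩
      suc (pred c)                  ≡⟨ suc-pred c ⟩
      c                             ∎
      where
      open ≡-Reasoning
      pred<c : pred c < c
      pred<c = subst (pred c <_) (suc-pred c) ≤-refl

    moves⇒mover : ∀ {j t} → j < c → Moves j t → j ≡ mover t
    moves⇒mover {j} {t} j<c moves = ℤ/c.offset-injective j<c (ℤ/c.forward-< (t % c) (pred c))
      (suc-injective (trans moves (sym (mover-moves t))))

    walker : Fin c → Seq (C n) (n * c)
    walker j t = position (toℕ j) (toℕ t) mod n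

    walker-inject₁ : ∀ j i → walker j (inject₁ i) ≡ position (toℕ j) (toℕ i) mod n
    walker-inject₁ j i = cong (λ t → position (toℕ j) t mod n) (toℕ-inject₁ i)

    walker-moves : ∀ j i → Moves (toℕ j) (toℕ i) → Adj (C n) (walker j (inject₁ i)) (walker j (Fin.suc i))
    walker-moves j i moves = subst₂ (Adj (C n)) (sym (walker-inject₁ j i))
      (cong (_mod n) (sym (position-moves (toℕ j) (toℕ i) moves))) (mod-adj _)

    walker-stays : ∀ j i → ¬ Moves (toℕ j) (toℕ i) → walker j (inject₁ i) ≡ walker j (Fin.suc i)
    walker-stays j i ¬moves =
      trans (walker-inject₁ j i) (cong (_mod n) (sym (position-stays (toℕ j) (toℕ i) ¬moves)))

    walker-weakWalk : ∀ j → WeakWalk (C n) (n * c) (walker j)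
    walker-weakWalk j i with suc ((toℕ i + toℕ j) % c) ℕ.≟ c
    ... | yes moves = inj₂ (walker-moves j i moves)
    ... | no ¬moves = inj₁ (walker-stays j i ¬moves)

    walkers-patient : Patient (C n) (n * c) walker
    walkers-patient = walker-weakWalk , λ i →
        fromℕ< (ℤ/c.forward-< (toℕ i % c) (pred c))
      , walker-moves _ i (subst (λ j → Moves j (toℕ i)) (sym (toℕ-fromℕ< _)) (mover-moves (toℕ i)))
      , λ j j≢mover → walker-stays j i (λ moves →
          j≢mover (toℕ-injective (trans (moves⇒mover (toℕ<n j) moves) (sym (toℕ-fromℕ< _)))))

    -- At the times t = q * c every walker j sits at j * d + q.
    walker-onto : ∀ j v → ∃[ t ] walker j t ≡ v
    walker-onto j v = fromℕ< (s≤s (*-monoˡ-≤ c (<⇒≤ q<n))) , %≡toℕ⇒mod≡ (begin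
      position (toℕ j) (toℕ (fromℕ< _)) % n
        ≡⟨ cong (λ t → position (toℕ j) t % n) (toℕ-fromℕ< _) ⟩
      (toℕ j * d + (q * c + toℕ j) / c) % n
        ≡⟨ cong (λ t → (toℕ j * d + t / c) % n) (+-comm (q * c) (toℕ j)) ⟩
      (toℕ j * d + (toℕ j + q * c) / c) % n
        ≡⟨ cong (λ t → (toℕ j * d + t) % n) (ℤ/c.[r+q*m]/m≡q q (toℕ<n j)) ⟩
      (toℕ j * d + q) % n
        ≡⟨ +-forward jd≤n (toℕ<n v) ⟩
      toℕ v ∎)
      where
      open ≡-Reasoning
      jd≤n : toℕ j * d ≤ n
      jd≤n = ≤-trans (*-monoˡ-≤ d (<⇒≤ (toℕ<n j))) (<⇒≤ cd<n)
      q : ℕ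
      q = forward (toℕ j * d) (toℕ v)
      q<n : q < n
      q<n = forward-< (toℕ j * d) (toℕ v)

    walkers-tour : PatientTour (C n) (n * c) walker
    walkers-tour = walkers-patient , λ j → walker-weakWalk j , walker-onto j

    position-gap : ∀ {a b} t → a < b → b < c →
                   ∃[ δ ] position b t ≡ position a t + δ × d ≤ δ × δ + d ≤ n
    position-gap {a} {b} t a<b b<c = k * d + h , b-position , d≤δ , δ+d≤n
      where
      k = b ∸ a
      X = (t + a) / c
      h = (t + b) / c ∸ X
      b≡a+k : b ≡ a + k
      b≡a+k = sym (m+[n∸m]≡n (<⇒≤ a<b))
      [t+b]/c≤1+X : (t + b) / c ≤ suc X
      [t+b]/c≤1+X = subst (λ y → y / c ≤ suc X) (trans (+-assoc t a k) (cong (t +_) (sym b≡a+k)))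
                          (ℤ/c.[x+k]/m≤1+x/m (t + a) (≤-<-trans (m∸n≤m b a) b<c))
      h≤1 : h ≤ 1
      h≤1 = ≤-trans (∸-monoˡ-≤ X [t+b]/c≤1+X) (≤-reflexive (m+n∸n≡m 1 X))
      [t+b]/c≡X+h : (t + b) / c ≡ X + h
      [t+b]/c≡X+h = sym (m+[n∸m]≡n (/-monoˡ-≤ c (+-monoʳ-≤ t (<⇒≤ a<b))))
      open +-*-Solver
      b-position : position b t ≡ position a t + (k * d + h)
      b-position = begin
        b * d + (t + b) / c       ≡⟨ cong₂ (λ x y → x * d + y) b≡a+k [t+b]/c≡X+h ⟩
        (a + k) * d + (X + h)     ≡⟨ solve 5 (λ a k d X h → (a :+ k) :* d :+ (X :+ h) := (a :* d :+ X) :+ (k :* d :+ h))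
                                             refl a k d X h ⟩
        a * d + X + (k * d + h)   ∎
        where open ≡-Reasoning
      d≤δ : d ≤ k * d + h
      d≤δ = ≤-trans (m≤n*m d k {{>-nonZero (m<n⇒0<n∸m a<b)}}) (m≤m+n (k * d) h)
      δ+d≤n : k * d + h + d ≤ n
      δ+d≤n = begin
        k * d + h + d   ≤⟨ +-monoˡ-≤ d (+-monoʳ-≤ (k * d) h≤1) ⟩
        k * d + 1 + d   ≡⟨ solve 2 (λ k d → k :* d :+ con 1 :+ d := con 1 :+ (con 1 :+ k) :* d) refl k d ⟩
        suc (suc k * d) ≤⟨ s≤s (*-monoˡ-≤ d (≤-trans (s≤s (m∸n≤m b a)) b<c)) ⟩
        suc (c * d)     ≤⟨ cd<n ⟩
        n               ∎
        where open ≤-Reasoning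

    positions-separated : ∀ {a b} t → a < b → b < c → d ≤ dist (position a t mod n) (position b t mod n)
    positions-separated {a} t a<b b<c with position-gap t a<b b<c
    ... | δ , b-position , d≤δ , δ+d≤n =
      subst (λ y → d ≤ dist (position a t mod n) (y mod n)) (sym b-position)
            (offset-separated _ 0<d d≤δ δ+d≤n)

    walkers-separated : ∀ t → Separated d (λ j → walker j t)
    walkers-separated t i j i≢j with <-cmp (toℕ i) (toℕ j)
    ... | tri< i<j _ _ = positions-separated (toℕ t) i<j (toℕ<n j)
    ... | tri≈ _ i≡j _ = contradiction (toℕ-injective i≡j) i≢j
    ... | tri> _ _ j<i =
      subst (d ≤_) (dist-comm (walker j t) (walker i t)) (positions-separated (toℕ t) j<i (toℕ<n i))

    walkers-FamMinDist : FamMinDist (C n) walker d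
    walkers-FamMinDist = separated⇒FamMinDist walkers-separated {t = Fin.zero} first≢second attained
      where
      first second : Fin c
      first  = fromℕ< (<-trans z<s 2≤c)
      second = fromℕ< 2≤c
      first≢second : first ≢ second
      first≢second eq = 0≢1+n (trans (sym (toℕ-fromℕ< _)) (trans (cong toℕ eq) (toℕ-fromℕ< _)))
      d<n : d < n
      d<n = ≤-<-trans (m≤n*m d c {{>-nonZero (<-trans z<s 2≤c)}}) cd<n
      d≤n∸d : d ≤ n ∸ d
      d≤n∸d = subst (λ x → d ≤ n ∸ x) (*-identityˡ d)
                    (m+n≤o⇒m≤o∸n d (≤-trans (*-monoˡ-≤ d 2≤c) (<⇒≤ cd<n)))
      attained : dist (walker first Fin.zero) (walker second Fin.zero) ≡ d
      attained = begin
        dist (position (toℕ first) 0 mod n) (position (toℕ second) 0 mod n)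
          ≡⟨ cong₂ (λ x y → dist (x mod n) (y mod n)) first-at-0 second-at-d ⟩
        dist (0 mod n) ((0 + d) mod n)
          ≡⟨ dist-offset 0 0<d d<n ⟩
        d ⊓ (n ∸ d)
          ≡⟨ m≤n⇒m⊓n≡m d≤n∸d ⟩
        d ∎
        where
        open ≡-Reasoning
        first-at-0 : position (toℕ first) 0 ≡ 0
        first-at-0 = trans (cong (λ j → position j 0) (toℕ-fromℕ< _)) (0/n≡0 c)
        second-at-d : position (toℕ second) 0 ≡ d
        second-at-d = trans (cong (λ j → position j 0) (toℕ-fromℕ< _))
                            (trans (cong₂ _+_ (*-identityˡ d) (m<n⇒m/n≡0 2≤c)) (+-identityʳ d))

  cycle-cap : ∀ {c d} → 0 < d → 2 * d < n → c * d < n → n ≤ suc c * d → IsCap (C n) d c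
  cycle-cap {c} {d} 0<d 2d<n cd<n n≤[1+c]d = (n * c , walker , walkers-tour , walkers-FamMinDist) , upper
    where
    2≤c : 2 ≤ c
    2≤c = s≤s⁻¹ (*-cancelʳ-< d 2 (suc c) (<-≤-trans 2d<n n≤[1+c]d))
    open RoundRobin 2≤c 0<d cd<n
    upper : ∀ c′ ℓ (F : Fin c′ → Seq (C n) ℓ) →
            PatientTour (C n) ℓ F → FamMinDist (C n) F d → c′ ≤ c
    upper c′ ℓ F tour F-min@((_ , _ , i≢j , _) , _) = s≤s⁻¹ (*-cancelʳ-< d c′ (suc c)
      (<-≤-trans (tour-packing tour (FamMinDist⇒separated F-min) i≢j) n≤[1+c]d))

proposition3p11 : (n d : ℕ) → .{{_ : NonZero d}} → 3 ≤ n
                  → (∃[ s ] (IsSigma (C n) s × d ≤ s))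
                  → (¬ (d ∣ n) → IsCap (C n) d (n / d))
                    × (d ∣ n → IsCap (C n) d (n / d ∸ 1))
proposition3p11 n d 3≤n (s , ((_ , F , σ-tour , s-min) , _) , d≤s) = cap-indivisible , cap-divisible
  where
  instance
    n≢0 : NonZero n
    n≢0 = >-nonZero (<-≤-trans z<s 3≤n)
  open Cycle n
  0<d : 0 < d
  0<d = >-nonZero⁻¹ d
  2d<n : 2 * d < n
  2d<n = tour-packing {i = Fin.zero} {Fin.suc Fin.zero} σ-tour
                      (MinDist⇒separated₂ {F = F} s-min d≤s) (λ ())
  cap-indivisible : ¬ d ∣ n → IsCap (C n) d (n / d)
  cap-indivisible d∤n = cycle-cap 0<d 2d<n ([m/n]*n<m d∤n) (<⇒≤ (m<[1+m/n]*n n d))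
  cap-divisible : d ∣ n → IsCap (C n) d (n / d ∸ 1)
  cap-divisible d∣n = cycle-cap 0<d 2d<n ([m/n∸1]*n<m d∣n) (≤-reflexive (m≡[1+[m/n∸1]]*n d∣n))
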